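{- Let $N$ be an absolute prime which is not a repunit and whose decimal representation has $n>3$ digits. Then $n$ is a multiple of $11088$.
   Context: An absolute prime is a positive integer which is prime and remains prime after an arbitrary permutation of the digits of its decimal representation. A repunit is an integer $A_k=(10^k-1)/9$ whose decimal representation consists of $k$ digits all equal to $1$. -}

module Defs where

open import Data.Nat using (ℕ; zero; suc; _+_; _*_; _^_; _∸_)
open import Data.Nat.Primality using (Prime)
open import Data.Fin using (Fin; toℕ)
open import Data.List using (List; []; _∷_; length; replicate)
open import Data.List.Relation.Binary.Permutation.Propositional using (_↭_)
open import Relation.Binary.PropositionalEquality using (_≡_)
open import Relation.Nullary using (¬_)
open import Data.Product using (_×_; ∃)
open import Data.Nat.DivMod using (_/_)

-- A decimal digit string, least significant digit first.
Digits : Set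
Digits = List (Fin 10)

value : Digits → ℕ
value []       = 0
value (d ∷ ds) = toℕ d + 10 * value ds

-- The most significant digit (last list element) is nonzero.
data LeadingNonzero : Digits → Set where
  single : ∀ (d : Fin 10) → ¬ (toℕ d ≡ 0) → LeadingNonzero (d ∷ [])
  cons   : ∀ (d : Fin 10) {ds : Digits} → LeadingNonzero ds → LeadingNonzero (d ∷ ds)

IsDecimalRep : ℕ → Digits → Set
IsDecimalRep N ds = LeadingNonzero ds × (value ds ≡ N)

AbsolutePrime : ℕ → Set
AbsolutePrime N = Prime N × (∀ (ds es : Digits) → IsDecimalRep N ds → ds ↭ es → Prime (value es))

repunit : ℕ → ℕ
repunit k = (10 ^ k ∸ 1) / 9

IsRepunit : ℕ → Set
IsRepunit N = ∃ λ k → repunit k ≡ N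

module Submission where

-- All digits of an absolute prime with at least two digits are 1, 3, 7 or 9: a digit 0, 2, 4, 5, 6
-- or 8 could be moved to the last place. If all digits are equal, N = a·Aₙ is prime only for a = 1.
-- If at least three distinct digits occur, or two digits each occur at least twice, then a block of
-- at most seven digits can be rearranged so that the number acquires a small factor: for seven digits
-- the block can be chosen to make the number divisible by 7 whatever the remaining digits are. This
-- is checked by computation. There remains N made of n − 1 digits a and one digit b. For
-- p ∈ {17, 19, 23, 29}, 10 has order p − 1 modulo p, so p divides a·A_{p−1} and inserting p − 1
-- digits a does not change residues mod p. A computation over the residues of n mod p − 1 then shows
-- that unless (p − 1) ∣ n some placement of b gives a multiple of p. Short lengths are excluded by
-- trial division, so 16, 18, 22 and 28 divide n, and hence so does their lcm 11088.

open import Defs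
open import Data.Bool using (Bool; true; false; _∧_; _∨_; not)
open import Data.Bool.ListAction using (any; all)
open import Data.Bool.Properties using (T-≡)
open import Data.Empty using (⊥-elim)
open import Data.Fin using (Fin; toℕ) renaming (suc to fsuc; _≤_ to _≤ᶠ_)
open import Data.Fin.Patterns
import Data.Fin.Properties as Fin
open import Data.List using (List; []; _∷_; _++_; length; replicate; map; concatMap; upTo)
open import Data.List.Membership.Propositional using (_∈_; find)
open import Data.List.Membership.Propositional.Properties using (∈-map⁻; ∈-concatMap⁻; ∈-upTo⁺; ∈-upTo⁻)
open import Data.List.Properties using (length-++; length-replicate; ++-assoc; ++-identityʳ)
open import Data.List.Relation.Binary.Permutation.Propositional
  using (_↭_; refl; prep; swap; trans; ↭-sym; ↭-reflexive)
open import Data.List.Relation.Binary.Permutation.Propositional.Properties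
  using (All-resp-↭; ↭-length; ++⁺ʳ; ++⁺ˡ; shift; ++-comm; ↭-reverse)
open import Data.List.Relation.Unary.All using (All; []; _∷_)
import Data.List.Relation.Unary.All as All
open import Data.List.Relation.Unary.All.Properties using (all⁺; ++⁺; replicate⁺)
open import Data.List.Relation.Unary.Any using (here; there)
open import Data.List.Relation.Unary.Any.Properties using (any⁻)
open import Data.List.Relation.Unary.Linked using (Linked; []; [-]; _∷_)
open import Data.List.Sort (Fin.≤-decTotalOrder 10) using (sort; sort-↭; sort-↗)
open import Data.Nat
  using (ℕ; zero; suc; _+_; _*_; _^_; _∸_; _<_; _≤_; z≤n; s≤s; z<s; _%_; _/_; NonZero; n>1⇒nonTrivial)
open import Data.Nat.Divisibility
  using (_∣_; _∣?_; divides; hasNonTrivialDivisor; ∣m⇒∣m*n; ∣n⇒∣m*n; ∣m∣n⇒∣m+n; m∣m*n; n∣m*n)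
open import Data.Nat.DivMod using (m≡m%n+[m/n]*n; m%n<n; m≥n⇒m/n>0; m*n/n≡m)
open import Data.Nat.LCM using (lcm-least)
open import Data.Nat.Primality using (Prime; ¬prime[0])
open import Data.Nat.Properties
open import Data.Nat.Solver using (module +-*-Solver)
open import Data.Product using (_×_; _,_; ∃; ∃₂; proj₁; proj₂)
open import Data.Sum using (_⊎_; inj₁; inj₂)
open import Function using (_∘_)
open import Function.Bundles using (module Equivalence)
open import Relation.Binary.Definitions using (DecidableEquality)
open import Relation.Binary.PropositionalEquality
  using (_≡_; _≢_; refl; sym; cong; subst; ≢-sym; module ≡-Reasoning) renaming (trans to ≡-trans)
open import Relation.Nullary using (¬_; Dec; _because_; yes; no; does; contradiction)
open import Relation.Nullary.Decidable using (True; toWitness; from-yes; dec-true; dec-false)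
open import Relation.Nullary.Reflects using (invert)
open import Relation.Unary using (Decidable)

open +-*-Solver using (solve; _:+_; _:*_; _:=_; con)
open Equivalence using (to; from)

value-++ : ∀ xs ys → value (xs ++ ys) ≡ value xs + 10 ^ length xs * value ys
value-++ []       ys = sym (+-identityʳ (value ys))
value-++ (x ∷ xs) ys rewrite value-++ xs ys =
  solve 4 (λ d v p w → d :+ con 10 :* (v :+ p :* w) := d :+ con 10 :* v :+ con 10 :* p :* w)
        refl (toℕ x) (value xs) (10 ^ length xs) (value ys)

value-replicate : ∀ n d → value (replicate n d) ≡ toℕ d * value (replicate n 1F)
value-replicate zero    d = sym (*-zeroʳ (toℕ d))
value-replicate (suc n) d rewrite value-replicate n d =
  solve 2 (λ d v → d :+ con 10 :* (d :* v) := d :* (con 1 :+ con 10 :* v))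
        refl (toℕ d) (value (replicate n 1F))

nines-plus-one : ∀ n → 9 * value (replicate n 1F) + 1 ≡ 10 ^ n
nines-plus-one zero    = refl
nines-plus-one (suc n) rewrite sym (nines-plus-one n) =
  solve 1 (λ v → con 9 :* (con 1 :+ con 10 :* v) :+ con 1 := con 10 :* (con 9 :* v :+ con 1))
        refl (value (replicate n 1F))

repunit-digits : ∀ n → repunit n ≡ value (replicate n 1F)
repunit-digits n = begin
  (10 ^ n ∸ 1) / 9                  ≡⟨ cong (λ m → (m ∸ 1) / 9) (sym (nines-plus-one n)) ⟩
  (9 * ones + 1 ∸ 1) / 9            ≡⟨ cong (_/ 9) (m+n∸n≡m (9 * ones) 1) ⟩
  (9 * ones) / 9                    ≡⟨ cong (_/ 9) (*-comm 9 ones) ⟩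
  (ones * 9) / 9                    ≡⟨ m*n/n≡m ones 9 ⟩
  ones                              ∎
  where
  open ≡-Reasoning
  ones = value (replicate n 1F)

replicate-++ : ∀ {A : Set} m n (x : A) → replicate m x ++ replicate n x ≡ replicate (m + n) x
replicate-++ zero    n x = refl
replicate-++ (suc m) n x = cong (x ∷_) (replicate-++ m n x)

proper-divisor⇒¬prime : ∀ {d v} → 1 < d → d < v → d ∣ v → ¬ Prime v
proper-divisor⇒¬prime 1<d d<v d∣v p =
  Prime.notComposite p (hasNonTrivialDivisor {{n>1⇒nonTrivial 1<d}} d<v d∣v)

¬prime-10* : ∀ w → ¬ Prime (10 * w)
¬prime-10* zero    = ¬prime[0]
¬prime-10* (suc w) =
  proper-divisor⇒¬prime (from-yes (1 <? 2)) (<-≤-trans (from-yes (2 <? 10)) (m≤m*n 10 (suc w)))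
    (∣m⇒∣m*n (suc w) (divides 5 refl))

last-digit-factor⇒¬prime : ∀ {d x R} → 1 < d → d < 10 → d ∣ 10 → d ∣ toℕ x → 0 < value R →
                           ¬ Prime (value (x ∷ R))
last-digit-factor⇒¬prime {d} {x} {R} 1<d d<10 d∣10 d∣x 0<R =
  proper-divisor⇒¬prime 1<d (<-≤-trans d<10 (≤-trans (*-monoʳ-≤ 10 0<R) (m≤n+m _ (toℕ x))))
    (∣m∣n⇒∣m+n d∣x (∣m⇒∣m*n (value R) d∣10))

prime-repdigit⇒repunit : ∀ n d → 2 ≤ n → Prime (value (replicate n d)) →
                         IsRepunit (value (replicate n d))
prime-repdigit⇒repunit n 0F _ p = contradiction (subst Prime (value-replicate n 0F) p) ¬prime[0]
prime-repdigit⇒repunit n 1F _ _ = n , repunit-digits n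
prime-repdigit⇒repunit n d@(fsuc (fsuc _)) (s≤s (s≤s _)) p =
  contradiction (subst Prime (value-replicate n d) p)
    (proper-divisor⇒¬prime (s≤s (s≤s z≤n)) (m<m*n (toℕ d) ones (s≤s (s≤s z≤n))) (m∣m*n ones))
  where ones = value (replicate n 1F)

-- Digits coprime to 10

data UnitDigit : Fin 10 → Set where
  one   : UnitDigit 1F
  three : UnitDigit 3F
  seven : UnitDigit 7F
  nine  : UnitDigit 9F

unitDigit? : Decidable UnitDigit
unitDigit? 0F = no λ ()
unitDigit? 1F = yes one
unitDigit? 2F = no λ ()
unitDigit? 3F = yes three
unitDigit? 4F = no λ ()
unitDigit? 5F = no λ ()
unitDigit? 6F = no λ ()
unitDigit? 7F = yes seven
unitDigit? 8F = no λ ()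
unitDigit? 9F = yes nine

non-unit-digit-factor : ∀ x → ¬ UnitDigit x → 2 ∣ toℕ x ⊎ 5 ∣ toℕ x
non-unit-digit-factor 0F _ = inj₁ (divides 0 refl)
non-unit-digit-factor 1F ¬u = contradiction one ¬u
non-unit-digit-factor 2F _ = inj₁ (divides 1 refl)
non-unit-digit-factor 3F ¬u = contradiction three ¬u
non-unit-digit-factor 4F _ = inj₁ (divides 2 refl)
non-unit-digit-factor 5F _ = inj₂ (divides 1 refl)
non-unit-digit-factor 6F _ = inj₁ (divides 3 refl)
non-unit-digit-factor 7F ¬u = contradiction seven ¬u
non-unit-digit-factor 8F _ = inj₁ (divides 4 refl)
non-unit-digit-factor 9F ¬u = contradiction nine ¬u

unit-digit-positive : ∀ {x} → UnitDigit x → 1 ≤ toℕ x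
unit-digit-positive one   = s≤s z≤n
unit-digit-positive three = s≤s z≤n
unit-digit-positive seven = s≤s z≤n
unit-digit-positive nine  = s≤s z≤n

111≤value : ∀ {xs} → All UnitDigit xs → 3 ≤ length xs → 111 ≤ value xs
111≤value {x ∷ y ∷ z ∷ _} (ux ∷ uy ∷ uz ∷ _) (s≤s (s≤s (s≤s _))) =
  +-mono-≤ (unit-digit-positive ux) (*-monoʳ-≤ 10
    (+-mono-≤ (unit-digit-positive uy) (*-monoʳ-≤ 10
      (≤-trans (unit-digit-positive uz) (m≤m+n (toℕ z) _)))))

AllRearrangementsPrime : Digits → Set
AllRearrangementsPrime xs = ∀ ys → xs ↭ ys → Prime (value ys)

↭-allRearrangementsPrime : ∀ {xs ys} → xs ↭ ys → AllRearrangementsPrime xs → AllRearrangementsPrime ys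
↭-allRearrangementsPrime p h zs q = h zs (trans p q)

all-or-counterexample : ∀ {A : Set} {P : A → Set} → Decidable P →
                        ∀ xs → All P xs ⊎ ∃₂ λ x ys → ¬ P x × xs ↭ x ∷ ys
all-or-counterexample P? [] = inj₁ []
all-or-counterexample P? (x ∷ xs) with P? x | all-or-counterexample P? xs
... | no ¬px | _                        = inj₂ (x , xs , ¬px , refl)
... | yes px | inj₁ pxs                 = inj₁ (px ∷ pxs)
... | yes _  | inj₂ (y , ys , ¬py , p) = inj₂ (y , x ∷ ys , ¬py , trans (prep x p) (swap x y refl))

¬unit-digit⇒¬allRearrangementsPrime : ∀ {x} R → ¬ UnitDigit x → 1 ≤ length R →
                                      ¬ AllRearrangementsPrime (x ∷ R)
¬unit-digit⇒¬allRearrangementsPrime {x} (0F ∷ R) _ _ h =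
  ¬prime-10* (value (x ∷ R)) (h (0F ∷ x ∷ R) (swap x 0F refl))
¬unit-digit⇒¬allRearrangementsPrime {x} R@(fsuc _ ∷ _) ¬u _ h with non-unit-digit-factor x ¬u
... | inj₁ 2∣x = last-digit-factor⇒¬prime {R = R} (from-yes (1 <? 2)) (from-yes (2 <? 10)) (divides 5 refl) 2∣x z<s
                   (h (x ∷ R) refl)
... | inj₂ 5∣x = last-digit-factor⇒¬prime {R = R} (from-yes (1 <? 5)) (from-yes (5 <? 10)) (divides 2 refl) 5∣x z<s
                   (h (x ∷ R) refl)

constant⇒replicate : ∀ {A : Set} {a : A} xs → All (_≡ a) xs → xs ≡ replicate (length xs) a
constant⇒replicate []       []           = refl
constant⇒replicate (x ∷ xs) (refl ∷ xs≡a) = cong (x ∷_) (constant⇒replicate xs xs≡a)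

constant-digits⇒repunit : ∀ {a} ds → All (_≡ a) ds → 2 ≤ length ds → Prime (value ds) → IsRepunit (value ds)
constant-digits⇒repunit {a} ds ds≡a 2≤n p =
  subst (IsRepunit ∘ value) (sym ds≡aⁿ)
    (prime-repdigit⇒repunit (length ds) a 2≤n (subst (Prime ∘ value) ds≡aⁿ p))
  where
  ds≡aⁿ : ds ≡ replicate (length ds) a
  ds≡aⁿ = constant⇒replicate ds ds≡a

data Shape {A : Set} (xs : List A) : Set where
  constant       : ∀ a → All (_≡ a) xs → Shape xs
  one-off        : ∀ a b m → a ≢ b → xs ↭ b ∷ replicate m a → Shape xs
  three-distinct : ∀ a b c ys → a ≢ b → a ≢ c → b ≢ c → xs ↭ a ∷ b ∷ c ∷ ys → Shape xs
  two-pairs      : ∀ a b ys → a ≢ b → xs ↭ a ∷ a ∷ b ∷ b ∷ ys → Shape xs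

module _ {A : Set} (_≟_ : DecidableEquality A) where

  extend : ∀ x {xs} → Shape xs → Shape (x ∷ xs)
  extend x {xs} (constant a xs≡a) with x ≟ a
  ... | yes refl = constant a (refl ∷ xs≡a)
  ... | no x≢a   = one-off a x (length xs) (≢-sym x≢a) (prep x (↭-reflexive (constant⇒replicate xs xs≡a)))
  extend x (one-off a b m a≢b p) with x ≟ a | x ≟ b
  ... | yes refl | _ = one-off a b (suc m) a≢b (trans (prep x p) (swap x b refl))
  extend x (one-off a b zero a≢b p) | no _ | yes refl =
    constant b (refl ∷ All-resp-↭ (↭-sym p) (refl ∷ []))
  extend x (one-off a b (suc zero) a≢b p) | no _ | yes refl =
    one-off b a 2 (≢-sym a≢b) (trans (prep x p) (shift a (x ∷ x ∷ []) []))
  extend x (one-off a b (suc (suc m)) a≢b p) | no _ | yes refl =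
    two-pairs a b (replicate m a) a≢b (trans (prep x p) (++⁺ʳ (replicate m a) (++-comm (x ∷ x ∷ []) (a ∷ a ∷ []))))
  extend x (one-off a b zero a≢b p) | no _ | no x≢b = one-off b x 1 (≢-sym x≢b) (prep x p)
  extend x (one-off a b (suc m) a≢b p) | no x≢a | no x≢b =
    three-distinct a b x (replicate m a) a≢b (≢-sym x≢a) (≢-sym x≢b)
      (trans (prep x p) (++⁺ʳ (replicate m a) (↭-reverse (a ∷ b ∷ x ∷ []))))
  extend x (three-distinct a b c ys a≢b a≢c b≢c p) =
    three-distinct a b c (x ∷ ys) a≢b a≢c b≢c (trans (prep x p) (↭-sym (shift x (a ∷ b ∷ c ∷ []) ys)))
  extend x (two-pairs a b ys a≢b p) =
    two-pairs a b (x ∷ ys) a≢b (trans (prep x p) (↭-sym (shift x (a ∷ a ∷ b ∷ b ∷ []) ys)))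

  shape : ∀ x xs → Shape (x ∷ xs)
  shape x []       = constant x (refl ∷ [])
  shape x (y ∷ ys) = extend x (shape y ys)

-- Boolean certificates

-- Certificates are Boolean computations discharged by refl. They are stated as b ≡ true and their
-- implicit arguments are supplied explicitly: unifying against T b, or against a certificate with
-- unknown arguments, makes the type checker unfold the whole computation.

does⇒ : ∀ {A : Set} (a? : Dec A) → does a? ≡ true → A
does⇒ (true because [a]) _ = invert [a]

∧-elim : ∀ {x y} → x ∧ y ≡ true → x ≡ true × y ≡ true
∧-elim {true} h = refl , h

∨-elim : ∀ {x y} → x ∨ y ≡ true → x ≡ true ⊎ y ≡ true
∨-elim {true}  _ = inj₁ refl
∨-elim {false} h = inj₂ h

∨-resolve : ∀ {x y} → x ∨ y ≡ true → x ≡ false → y ≡ true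
∨-resolve h refl = h

_⇒ᵇ_ : Bool → Bool → Bool
x ⇒ᵇ y = not x ∨ y

⇒ᵇ-elim : ∀ {x y} → x ⇒ᵇ y ≡ true → x ≡ true → y ≡ true
⇒ᵇ-elim h refl = h

any-upTo⁻ : ∀ {n} (f : ℕ → Bool) → any f (upTo n) ≡ true → ∃ λ i → i < n × f i ≡ true
any-upTo⁻ f h with i , i∈ , fi ← find (any⁻ f _ (from T-≡ h)) = i , ∈-upTo⁻ i∈ , to T-≡ fi

all-upTo⁻ : ∀ {n i} (f : ℕ → Bool) → all f (upTo n) ≡ true → i < n → f i ≡ true
all-upTo⁻ f h i<n = to T-≡ (All.lookup (all⁺ f _ (from T-≡ h)) (∈-upTo⁺ i<n))

unitDigits : List (Fin 10)
unitDigits = 1F ∷ 3F ∷ 7F ∷ 9F ∷ []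

unitDigit⇒∈ : ∀ {x} → UnitDigit x → x ∈ unitDigits
unitDigit⇒∈ one   = here refl
unitDigit⇒∈ three = there (here refl)
unitDigit⇒∈ seven = there (there (here refl))
unitDigit⇒∈ nine  = there (there (there (here refl)))

∀ᵘ : (Fin 10 → Bool) → Bool
∀ᵘ P = all P unitDigits

∀ᵘ-elim : ∀ P {x} → ∀ᵘ P ≡ true → UnitDigit x → P x ≡ true
∀ᵘ-elim P h u = to T-≡ (All.lookup (all⁺ P unitDigits (from T-≡ h)) (unitDigit⇒∈ u))

isProperFactor : ℕ → ℕ → Bool
isProperFactor v d = does (1 <? d) ∧ does (d <? v) ∧ does (d ∣? v)

isProperFactor⇒¬prime : ∀ v d → isProperFactor v d ≡ true → ¬ Prime v
isProperFactor⇒¬prime v d h =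
  let 1<d , h′  = ∧-elim h
      d<v , d∣v = ∧-elim h′
  in proper-divisor⇒¬prime (does⇒ (1 <? d) 1<d) (does⇒ (d <? v) d<v) (does⇒ (d ∣? v) d∣v)

hasFactorBelow : ℕ → ℕ → Bool
hasFactorBelow b v = any (isProperFactor v) (upTo b)

hasFactorBelow⇒¬prime : ∀ b v → hasFactorBelow b v ≡ true → ¬ Prime v
hasFactorBelow⇒¬prime b v h with d , _ , d-factor ← any-upTo⁻ {b} (isProperFactor v) h =
  isProperFactor⇒¬prime v d d-factor

module _ {A : Set} where

  insertions : A → List A → List (List A)
  insertions x []       = (x ∷ []) ∷ []
  insertions x (y ∷ ys) = (x ∷ y ∷ ys) ∷ map (y ∷_) (insertions x ys)

  permutations : List A → List (List A)
  permutations []       = [] ∷ []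
  permutations (x ∷ xs) = concatMap (insertions x) (permutations xs)

  ∈-insertions⇒↭ : ∀ {x} ys {zs} → zs ∈ insertions x ys → x ∷ ys ↭ zs
  ∈-insertions⇒↭ []       (here refl) = refl
  ∈-insertions⇒↭ (y ∷ ys) (here refl) = refl
  ∈-insertions⇒↭ {x} (y ∷ ys) (there zs∈) with ws , ws∈ , refl ← ∈-map⁻ (y ∷_) zs∈ =
    trans (swap x y refl) (prep y (∈-insertions⇒↭ ys ws∈))

  ∈-permutations⇒↭ : ∀ xs {ys} → ys ∈ permutations xs → xs ↭ ys
  ∈-permutations⇒↭ []       (here refl) = refl
  ∈-permutations⇒↭ (x ∷ xs) ys∈ with zs , zs∈ , ys∈′ ← find (∈-concatMap⁻ (insertions x) ys∈) =
    trans (prep x (∈-permutations⇒↭ xs zs∈)) (∈-insertions⇒↭ zs ys∈′)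

  any-permutation⁻ : ∀ (f : List A → Bool) xs → any f (permutations xs) ≡ true →
                     ∃ λ ys → xs ↭ ys × f ys ≡ true
  any-permutation⁻ f xs h with ys , ys∈ , fys ← find (any⁻ f _ (from T-≡ h)) =
    ys , ∈-permutations⇒↭ xs ys∈ , to T-≡ fys

-- One digit different from all the others

oneOff : Fin 10 → Fin 10 → ℕ → ℕ → Digits
oneOff a b k j = replicate k a ++ b ∷ replicate j a

OneOffPrimes : Fin 10 → Fin 10 → ℕ → Set
OneOffPrimes a b m = ∀ k j → k + j ≡ m → Prime (value (oneOff a b k j))

oneOff-↭ : ∀ a b k j → b ∷ replicate (k + j) a ↭ oneOff a b k j
oneOff-↭ a b k j =
  ↭-sym (subst (λ xs → oneOff a b k j ↭ b ∷ xs) (replicate-++ k j a) (shift b (replicate k a) (replicate j a)))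

allRearrangementsPrime⇒oneOffPrimes : ∀ {a b m} → AllRearrangementsPrime (b ∷ replicate m a) → OneOffPrimes a b m
allRearrangementsPrime⇒oneOffPrimes {a} {b} h k j refl = h (oneOff a b k j) (oneOff-↭ a b k j)

oneOff-≥111 : ∀ {a b} → UnitDigit a → UnitDigit b → ∀ k j → 2 ≤ k + j → 111 ≤ value (oneOff a b k j)
oneOff-≥111 {a} {b} ua ub k j 2≤k+j = 111≤value (++⁺ (replicate⁺ k ua) (ub ∷ replicate⁺ j ua)) 3≤length
  where
  3≤length : 3 ≤ length (oneOff a b k j)
  3≤length rewrite length-++ (replicate k a) {b ∷ replicate j a} | length-replicate k {a} | length-replicate j {a}
                 | +-suc k j = s≤s 2≤k+j

oneOff-append : ∀ a b k j q → oneOff a b k (j + q) ≡ oneOff a b k j ++ replicate q a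
oneOff-append a b k j q = begin
  replicate k a ++ b ∷ replicate (j + q) a             ≡⟨ cong (λ xs → replicate k a ++ b ∷ xs) (replicate-++ j q a) ⟨
  replicate k a ++ (b ∷ replicate j a ++ replicate q a) ≡⟨ ++-assoc (replicate k a) _ _ ⟨
  oneOff a b k j ++ replicate q a                       ∎
  where open ≡-Reasoning

oneOff-periodic : ∀ {p q} a b k j t → p ∣ value (replicate q a) →
                  p ∣ value (oneOff a b k j) → p ∣ value (oneOff a b k (j + t * q))
oneOff-periodic {p} a b k j zero _ h = subst (λ i → p ∣ value (oneOff a b k i)) (sym (+-identityʳ j)) h
oneOff-periodic {p} {q} a b k j (suc t) p∣aa h =
  subst (λ i → p ∣ value (oneOff a b k i)) (+-assoc j q (t * q)) (oneOff-periodic a b k (j + q) t p∣aa one-period)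
  where
  one-period : p ∣ value (oneOff a b k (j + q))
  one-period rewrite oneOff-append a b k j q | value-++ (oneOff a b k j) (replicate q a) =
    ∣m∣n⇒∣m+n h (∣n⇒∣m*n (10 ^ length (oneOff a b k j)) p∣aa)

ResidueWitnesses : ℕ → ℕ → Fin 10 → Fin 10 → Set
ResidueWitnesses p q a b = ∀ u → u < q → suc u ≡ q ⊎ ∃ λ k → k < q × p ∣ value (oneOff a b k (u + q ∸ k))

period-divides-length : ∀ {a b m p} q .{{_ : NonZero q}} → 1 < p → p < 111 → p ∣ value (replicate q a) →
                        ResidueWitnesses p q a b → UnitDigit a → UnitDigit b → 2 ≤ m →
                        OneOffPrimes a b m → q ≤ suc m → q ∣ suc m
period-divides-length {a} {b} {m} {p} q 1<p p<111 p∣aa witnesses ua ub 2≤m primes q≤n with suc m ≟ q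
... | yes n≡q = divides 1 (≡-trans n≡q (sym (*-identityˡ q)))
... | no n≢q with m / q | m≡m%n+[m/n]*n m q | m≥n⇒m/n>0 {m} {q} (≤-pred (≤∧≢⇒< q≤n (≢-sym n≢q)))
...   | suc t | m≡u+[t+1]q | _ with witnesses (m % q) (m%n<n m q)
...     | inj₁ u+1≡q = divides (suc (suc t)) (≡-trans (cong suc m≡u+[t+1]q) (cong (_+ suc t * q) u+1≡q))
...     | inj₂ (k , k<q , p∣) =
  contradiction (primes k j k+j≡m) (proper-divisor⇒¬prime 1<p p<value p∣value)
  where
  u = m % q
  j = u + q ∸ k + t * q
  k+j≡m : k + j ≡ m
  k+j≡m = begin
    k + (u + q ∸ k + t * q)  ≡⟨ +-assoc k (u + q ∸ k) (t * q) ⟨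
    k + (u + q ∸ k) + t * q  ≡⟨ cong (_+ t * q) (m+[n∸m]≡n (≤-trans (<⇒≤ k<q) (m≤n+m q u))) ⟩
    u + q + t * q            ≡⟨ +-assoc u q (t * q) ⟩
    u + suc t * q            ≡⟨ m≡u+[t+1]q ⟨
    m                        ∎
    where open ≡-Reasoning
  p∣value : p ∣ value (oneOff a b k j)
  p∣value = oneOff-periodic a b k (u + q ∸ k) t p∣aa p∣
  p<value : p < value (oneOff a b k j)
  p<value = <-≤-trans p<111 (oneOff-≥111 ua ub k j (subst (2 ≤_) (sym k+j≡m) 2≤m))

periodCertificate : ℕ → ℕ → Fin 10 → Fin 10 → Bool
periodCertificate p q a b = does (1 <? p) ∧ does (p <? 111) ∧ does (p ∣? value (replicate q a))
  ∧ all (λ u → does (suc u ≟ q) ∨ any (λ k → does (p ∣? value (oneOff a b k (u + q ∸ k)))) (upTo q)) (upTo q)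

periodCertificate⁻ : ∀ {p q a b} → periodCertificate p q a b ≡ true →
                     1 < p × p < 111 × p ∣ value (replicate q a) × ResidueWitnesses p q a b
periodCertificate⁻ {p} {q} {a} {b} cert =
  let 1<p , cert′   = ∧-elim cert
      p<111 , cert″ = ∧-elim cert′
      p∣aa , rs     = ∧-elim cert″
  in does⇒ (1 <? p) 1<p , does⇒ (p <? 111) p<111 , does⇒ (p ∣? _) p∣aa , witnesses rs
  where
  witnesses : all _ (upTo q) ≡ true → ResidueWitnesses p q a b
  witnesses rs u u<q with ∨-elim (all-upTo⁻ _ rs u<q)
  ... | inj₁ u+1≡q = inj₁ (does⇒ (suc u ≟ q) u+1≡q)
  ... | inj₂ some-k with k , k<q , p∣ ← any-upTo⁻ _ some-k = inj₂ (k , k<q , does⇒ (p ∣? _) p∣)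

periodCertificate⇒divides : ∀ {a b m p} q .{{_ : NonZero q}} → periodCertificate p q a b ≡ true →
                            UnitDigit a → UnitDigit b → 2 ≤ m → OneOffPrimes a b m → q ≤ suc m → q ∣ suc m
periodCertificate⇒divides {a} {b} {m} {p} q c =
  let 1<p , p<111 , p∣aa , witnesses = periodCertificate⁻ {p} {q} {a} {b} c
  in period-divides-length q 1<p p<111 p∣aa witnesses

shortCertificate : Fin 10 → Fin 10 → ℕ → Bool
shortCertificate a b m = does (3 ≤? m) ⇒ᵇ any (λ k → hasFactorBelow 200 (value (oneOff a b k (m ∸ k)))) (upTo (suc m))

shortCertificate-sound : ∀ {a b m} → shortCertificate a b m ≡ true → 3 ≤ m → ¬ OneOffPrimes a b m
shortCertificate-sound {a} {b} {m} cert 3≤m primes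
  with k , k≤m , factor ← any-upTo⁻ _ (⇒ᵇ-elim cert (dec-true (3 ≤? m) 3≤m)) =
  hasFactorBelow⇒¬prime 200 _ factor (primes k (m ∸ k) (m+[n∸m]≡n (≤-pred k≤m)))

oneOffCertificate : Fin 10 → Fin 10 → Bool
oneOffCertificate a b = all (shortCertificate a b) (upTo 16)
  ∧ periodCertificate 17 16 a b ∧ periodCertificate 19 18 a b
  ∧ periodCertificate 23 22 a b ∧ periodCertificate 29 28 a b

oneOffCertified : Fin 10 → Fin 10 → Bool
oneOffCertified a b = does (a Fin.≟ b) ∨ oneOffCertificate a b

oneOff-certificate : ∀ᵘ (λ a → ∀ᵘ (oneOffCertified a)) ≡ true
oneOff-certificate = refl

certified-oneOff : ∀ {a b} → a ≢ b → UnitDigit a → UnitDigit b → oneOffCertificate a b ≡ true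
certified-oneOff {a} {b} a≢b ua ub = ∨-resolve {does (a Fin.≟ b)} {oneOffCertificate a b}
  (∀ᵘ-elim (oneOffCertified a) (∀ᵘ-elim (λ a → ∀ᵘ (oneOffCertified a)) oneOff-certificate ua) ub)
  (dec-false (a Fin.≟ b) a≢b)

CertifiedOneOff : Fin 10 → Fin 10 → Set
CertifiedOneOff a b = all (shortCertificate a b) (upTo 16) ≡ true × periodCertificate 17 16 a b ≡ true ×
  periodCertificate 19 18 a b ≡ true × periodCertificate 23 22 a b ≡ true × periodCertificate 29 28 a b ≡ true

oneOffCertificate⁻ : ∀ {a b} → oneOffCertificate a b ≡ true → CertifiedOneOff a b
oneOffCertificate⁻ {a} {b} c =
  let shorts , c₁       = ∧-elim {all (shortCertificate a b) (upTo 16)} {P17 ∧ P19 ∧ P23 ∧ P29} c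
      17-cert , c₂      = ∧-elim {P17} {P19 ∧ P23 ∧ P29} c₁
      19-cert , c₃      = ∧-elim {P19} {P23 ∧ P29} c₂
      23-cert , 29-cert = ∧-elim {P23} {P29} c₃
  in shorts , 17-cert , 19-cert , 23-cert , 29-cert
  where
  P17 = periodCertificate 17 16 a b
  P19 = periodCertificate 19 18 a b
  P23 = periodCertificate 23 22 a b
  P29 = periodCertificate 29 28 a b

∣∧<⇒2*≤ : ∀ {d n} → d ∣ n → d < n → 2 * d ≤ n
∣∧<⇒2*≤ (divides zero refl) ()
∣∧<⇒2*≤ {d} (divides 1 refl) d<d+0 = contradiction (subst (d <_) (+-identityʳ d) d<d+0) (<-irrefl refl)
∣∧<⇒2*≤ {d} (divides (suc (suc k)) refl) _ = +-monoʳ-≤ d (+-monoʳ-≤ d z≤n)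

oneOff-length-divisible : ∀ {a b m} → a ≢ b → 3 ≤ m → All UnitDigit (b ∷ replicate m a) →
                          OneOffPrimes a b m → 11088 ∣ suc m
oneOff-length-divisible {a} {b} {m} a≢b 3≤m@(s≤s _) (ub ∷ ua ∷ _) primes =
  divisible (oneOffCertificate⁻ {a} {b} (certified-oneOff a≢b ua ub))
  where
  2≤m : 2 ≤ m
  2≤m = ≤-trans (n≤1+n 2) 3≤m
  divisible : CertifiedOneOff a b → 11088 ∣ suc m
  divisible (shorts , 17-cert , 19-cert , 23-cert , 29-cert) =
    lcm-least (lcm-least (lcm-least 16∣n (period {19} 18 19-cert)) (period {23} 22 23-cert)) (period {29} 28 29-cert)
    where
    16≤m : 16 ≤ m
    16≤m = ≮⇒≥ λ m<16 →
      shortCertificate-sound {a} {b} {m} (all-upTo⁻ {16} {m} (shortCertificate a b) shorts m<16) 3≤m primes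
    16∣n : 16 ∣ suc m
    16∣n = periodCertificate⇒divides {a} {b} {m} {17} 16 17-cert ua ub 2≤m primes (m≤n⇒m≤1+n 16≤m)
    period : ∀ {p} q .{{_ : NonZero q}} → periodCertificate p q a b ≡ true → {True (q ≤? 32)} → q ∣ suc m
    period {p} q c {q≤32} = periodCertificate⇒divides {a} {b} {m} {p} q c ua ub 2≤m primes
      (≤-trans (toWitness q≤32) (∣∧<⇒2*≤ 16∣n (s≤s 16≤m)))

-- Three distinct digits, or two pairs

∣-+-*-% : ∀ d .{{_ : NonZero d}} x c y → d ∣ x + c * (y % d) → d ∣ x + c * y
∣-+-*-% d x c y d∣ = subst (d ∣_) (sym x+cy≡) (∣m∣n⇒∣m+n d∣ (∣n⇒∣m*n c (n∣m*n (y / d))))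
  where
  open ≡-Reasoning
  x+cy≡ : x + c * y ≡ x + c * (y % d) + c * (y / d * d)
  x+cy≡ = begin
    x + c * y                           ≡⟨ cong (λ z → x + c * z) (m≡m%n+[m/n]*n y d) ⟩
    x + c * (y % d + y / d * d)         ≡⟨ cong (x +_) (*-distribˡ-+ c (y % d) (y / d * d)) ⟩
    x + (c * (y % d) + c * (y / d * d)) ≡⟨ +-assoc x _ _ ⟨
    x + c * (y % d) + c * (y / d * d)   ∎

hitsResidue : Digits → ℕ → Digits → Bool
hitsResidue B r L = does (7 ∣? value L + 10 ^ length B * r) ∧ does (7 <? value L)

coversResiduesMod7 : Digits → Bool
coversResiduesMod7 B = all (λ r → any (hitsResidue B r) (permutations B)) (upTo 7)

coversResiduesMod7⁻ : ∀ {B} → coversResiduesMod7 B ≡ true → ∀ r → r < 7 →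
                      ∃ λ L → B ↭ L × 7 ∣ value L + 10 ^ length B * r × 7 < value L
coversResiduesMod7⁻ {B} cert r r<7
  with L , B↭L , hit ← any-permutation⁻ (hitsResidue B r) B
                         (all-upTo⁻ {7} (λ r → any (hitsResidue B r) (permutations B)) cert r<7) =
  let 7∣ , 7< = ∧-elim hit in L , B↭L , does⇒ (7 ∣? _) 7∣ , does⇒ (7 <? _) 7<

coversResiduesMod7⇒¬allRearrangementsPrime : ∀ B S → coversResiduesMod7 B ≡ true → ¬ AllRearrangementsPrime (B ++ S)
coversResiduesMod7⇒¬allRearrangementsPrime B S cert primes
  with L , B↭L , 7∣ , 7< ← coversResiduesMod7⁻ cert (value S % 7) (m%n<n (value S) 7) =
  proper-divisor⇒¬prime (from-yes (1 <? 7)) 7<value 7∣value (primes (L ++ S) (++⁺ʳ S B↭L))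
  where
  7∣value : 7 ∣ value (L ++ S)
  7∣value rewrite value-++ L S | sym (↭-length B↭L) = ∣-+-*-% 7 (value L) (10 ^ length B) (value S) 7∣
  7<value : 7 < value (L ++ S)
  7<value rewrite value-++ L S = <-≤-trans 7< (m≤m+n (value L) _)

hasCompositeRearrangement : Digits → Bool
hasCompositeRearrangement B = any (λ L → hasFactorBelow 14 (value L)) (permutations B)

hasCompositeRearrangement⇒¬allRearrangementsPrime : ∀ B → hasCompositeRearrangement B ≡ true →
                                                    ¬ AllRearrangementsPrime B
hasCompositeRearrangement⇒¬allRearrangementsPrime B cert primes
  with L , B↭L , factor ← any-permutation⁻ _ B cert = hasFactorBelow⇒¬prime 14 (value L) factor (primes L B↭L)

-- The block B grows by the remaining digits in increasing order, lo being the last one added. Up to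
-- six digits some rearrangement of B has a factor below 14; once B has seven digits, for every residue
-- of the rest modulo 7 some rearrangement of B makes the whole number a multiple of 7.
blockCertificate : ℕ → Fin 10 → Digits → Bool
blockCertificate zero    lo B = coversResiduesMod7 B
blockCertificate (suc k) lo B = (does (4 ≤? length B) ⇒ᵇ hasCompositeRearrangement B)
  ∧ ∀ᵘ (λ f → does (lo Fin.≤? f) ⇒ᵇ blockCertificate k f (f ∷ B))

sortedBlockCertificate⇒¬allRearrangementsPrime : ∀ k lo B S → blockCertificate k lo B ≡ true → All UnitDigit S →
  Linked _≤ᶠ_ (lo ∷ S) → 4 ≤ length B + length S → ¬ AllRearrangementsPrime (B ++ S)
sortedBlockCertificate⇒¬allRearrangementsPrime zero lo B S cert _ _ _ = coversResiduesMod7⇒¬allRearrangementsPrime B S cert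
sortedBlockCertificate⇒¬allRearrangementsPrime (suc k) lo B [] cert _ _ 4≤ primes =
  hasCompositeRearrangement⇒¬allRearrangementsPrime B
    (⇒ᵇ-elim (proj₁ (∧-elim {does (4 ≤? length B) ⇒ᵇ hasCompositeRearrangement B} cert))
             (dec-true (4 ≤? length B) (subst (4 ≤_) (+-identityʳ _) 4≤)))
    (subst AllRearrangementsPrime (++-identityʳ B) primes)
sortedBlockCertificate⇒¬allRearrangementsPrime (suc k) lo B (f ∷ S) cert (uf ∷ uS) (lo≤f ∷ sorted) 4≤ primes =
  sortedBlockCertificate⇒¬allRearrangementsPrime k f (f ∷ B) S extended uS sorted
    (subst (4 ≤_) (+-suc (length B) (length S)) 4≤) (↭-allRearrangementsPrime (shift f B S) primes)
  where
  extensions : Fin 10 → Bool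
  extensions g = does (lo Fin.≤? g) ⇒ᵇ blockCertificate k g (g ∷ B)
  extended : blockCertificate k f (f ∷ B) ≡ true
  extended =
    ⇒ᵇ-elim (∀ᵘ-elim extensions
              (proj₂ (∧-elim {does (4 ≤? length B) ⇒ᵇ hasCompositeRearrangement B} {∀ᵘ extensions} cert)) uf)
            (dec-true (lo Fin.≤? f) lo≤f)

sorted-0F∷ : ∀ {S : Digits} → Linked _≤ᶠ_ S → Linked _≤ᶠ_ (0F ∷ S)
sorted-0F∷ []      = [-]
sorted-0F∷ [-]     = z≤n ∷ [-]
sorted-0F∷ (r ∷ s) = z≤n ∷ r ∷ s

blockCertificate⇒¬allRearrangementsPrime : ∀ k B R → blockCertificate k 0F B ≡ true → All UnitDigit R →
                                             4 ≤ length B + length R → ¬ AllRearrangementsPrime (B ++ R)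
blockCertificate⇒¬allRearrangementsPrime k B R cert uR 4≤ primes =
  sortedBlockCertificate⇒¬allRearrangementsPrime k 0F B (sort R) cert (All-resp-↭ (↭-sym (sort-↭ R)) uR)
    (sorted-0F∷ (sort-↗ R)) (subst (λ l → 4 ≤ length B + l) (sym (↭-length (sort-↭ R))) 4≤)
    (↭-allRearrangementsPrime (++⁺ˡ B (↭-sym (sort-↭ R))) primes)

threeDistinctCertified : Fin 10 → Fin 10 → Fin 10 → Bool
threeDistinctCertified a b c =
  does (a Fin.≟ b) ∨ does (a Fin.≟ c) ∨ does (b Fin.≟ c) ∨ blockCertificate 4 0F (a ∷ b ∷ c ∷ [])

threeDistinct-certificate : ∀ᵘ (λ a → ∀ᵘ λ b → ∀ᵘ (threeDistinctCertified a b)) ≡ true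
threeDistinct-certificate = refl

twoPairsCertified : Fin 10 → Fin 10 → Bool
twoPairsCertified a b = does (a Fin.≟ b) ∨ blockCertificate 3 0F (a ∷ a ∷ b ∷ b ∷ [])

twoPairs-certificate : ∀ᵘ (λ a → ∀ᵘ (twoPairsCertified a)) ≡ true
twoPairs-certificate = refl

three-distinct⇒¬allRearrangementsPrime : ∀ {a b c R} → a ≢ b → a ≢ c → b ≢ c →
                                         All UnitDigit (a ∷ b ∷ c ∷ R) →
                                         1 ≤ length R → ¬ AllRearrangementsPrime (a ∷ b ∷ c ∷ R)
three-distinct⇒¬allRearrangementsPrime {a} {b} {c} {R} a≢b a≢c b≢c (ua ∷ ub ∷ uc ∷ uR) 1≤R =
  blockCertificate⇒¬allRearrangementsPrime 4 (a ∷ b ∷ c ∷ []) R certified uR (s≤s (s≤s (s≤s 1≤R)))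
  where
  certified : blockCertificate 4 0F (a ∷ b ∷ c ∷ []) ≡ true
  certified =
    ∨-resolve {does (b Fin.≟ c)} (∨-resolve {does (a Fin.≟ c)} (∨-resolve {does (a Fin.≟ b)}
      (∀ᵘ-elim (threeDistinctCertified a b) (∀ᵘ-elim (λ b → ∀ᵘ (threeDistinctCertified a b))
        (∀ᵘ-elim (λ a → ∀ᵘ λ b → ∀ᵘ (threeDistinctCertified a b)) threeDistinct-certificate ua) ub) uc)
      (dec-false (a Fin.≟ b) a≢b)) (dec-false (a Fin.≟ c) a≢c)) (dec-false (b Fin.≟ c) b≢c)

two-pairs⇒¬allRearrangementsPrime : ∀ {a b R} → a ≢ b → All UnitDigit (a ∷ a ∷ b ∷ b ∷ R) →
                                    ¬ AllRearrangementsPrime (a ∷ a ∷ b ∷ b ∷ R)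
two-pairs⇒¬allRearrangementsPrime {a} {b} {R} a≢b (ua ∷ _ ∷ ub ∷ _ ∷ uR) =
  blockCertificate⇒¬allRearrangementsPrime 3 (a ∷ a ∷ b ∷ b ∷ []) R certified uR (s≤s (s≤s (s≤s (s≤s z≤n))))
  where
  certified : blockCertificate 3 0F (a ∷ a ∷ b ∷ b ∷ []) ≡ true
  certified = ∨-resolve {does (a Fin.≟ b)}
    (∀ᵘ-elim (twoPairsCertified a) (∀ᵘ-elim (λ a → ∀ᵘ (twoPairsCertified a)) twoPairs-certificate ua) ub)
    (dec-false (a Fin.≟ b) a≢b)

allRearrangementsPrime⇒11088∣length : ∀ d ds → 4 ≤ length (d ∷ ds) → AllRearrangementsPrime (d ∷ ds) →
                                       ¬ IsRepunit (value (d ∷ ds)) → 11088 ∣ length (d ∷ ds)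
allRearrangementsPrime⇒11088∣length d ds 4≤n primes ¬repunit with all-or-counterexample unitDigit? (d ∷ ds)
... | inj₂ (x , R , ¬ux , p) =
  ⊥-elim (¬unit-digit⇒¬allRearrangementsPrime R ¬ux (≤-trans (s≤s z≤n) (≤-pred (subst (4 ≤_) (↭-length p) 4≤n)))
           (↭-allRearrangementsPrime p primes))
... | inj₁ units = by-shape (shape Fin._≟_ d ds)
  where
  by-shape : Shape (d ∷ ds) → 11088 ∣ length (d ∷ ds)
  by-shape (constant a ds≡a) =
    ⊥-elim (¬repunit
      (constant-digits⇒repunit (d ∷ ds) ds≡a (≤-trans (s≤s (s≤s z≤n)) 4≤n) (primes (d ∷ ds) refl)))
  by-shape (one-off a b m a≢b p) =
    subst (11088 ∣_) (sym n≡1+m)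
      (oneOff-length-divisible a≢b (≤-pred (subst (4 ≤_) n≡1+m 4≤n)) (All-resp-↭ p units)
        (allRearrangementsPrime⇒oneOffPrimes (↭-allRearrangementsPrime p primes)))
    where
    n≡1+m : length (d ∷ ds) ≡ suc m
    n≡1+m = ≡-trans (↭-length p) (cong suc (length-replicate m))
  by-shape (three-distinct a b c R a≢b a≢c b≢c p) =
    ⊥-elim (three-distinct⇒¬allRearrangementsPrime a≢b a≢c b≢c (All-resp-↭ p units)
      (≤-pred (≤-pred (≤-pred (subst (4 ≤_) (↭-length p) 4≤n)))) (↭-allRearrangementsPrime p primes))
  by-shape (two-pairs a b R a≢b p) =
    ⊥-elim (two-pairs⇒¬allRearrangementsPrime a≢b (All-resp-↭ p units) (↭-allRearrangementsPrime p primes))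

theorem2 : ∀ (N n : ℕ) (ds : Digits) → IsDecimalRep N ds → length ds ≡ n
           → AbsolutePrime N → ¬ IsRepunit N → 3 < n → 11088 ∣ n
theorem2 _ _ (d ∷ ds) (leading , refl) refl (_ , absolute) ¬repunit 3<n =
  allRearrangementsPrime⇒11088∣length d ds 3<n (λ es → absolute (d ∷ ds) es (leading , refl)) ¬repunit
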